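{- Let $G$ be a finite simple connected graph. Then the fault tolerant zero forcing number $\mathrm{Z}_t(G)$ exists (i.e., $G$ has at least one fault tolerant zero forcing set) if and only if $G \not\cong K_1$.
   Context: Zero forcing: given a set $B\subseteq V(G)$ of initially blue vertices (all others white), the color change rule allows a blue vertex $b$ to turn a white vertex $w$ blue if $w$ is the unique white neighbor of $b$ (written $b\to w$). $B$ is a zero forcing set if repeated application of this rule eventually turns all of $V(G)$ blue. For an integer $k\ge 1$, a set $B\subseteq V(G)$ with $|B|=m\ge k$ is a $k$-fault tolerant zero forcing set if every subset $F\subseteq B$ with $|F|=m-k$ is a zero forcing set of $G$. The $k$-fault tolerant zero forcing number $\mathrm{Z}_t^k(G)$ is the minimum cardinality of a $k$-fault tolerant zero forcing set of $G$; it is said not to exist if no such set exists. $\mathrm{Z}_t(G)$ denotes $\mathrm{Z}_t^1(G)$, and a $1$-fault tolerant zero forcing set is called a fault tolerant zero forcing set. -}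

module Defs where

open import Data.Nat using (ℕ; _≤_; _∸_)
open import Data.Fin using (Fin)
open import Data.Fin.Subset using (Subset; _∈_; _⊆_; ∣_∣)
open import Data.Product using (Σ; ∃; _×_)
open import Relation.Binary.PropositionalEquality using (_≡_; _≢_)
open import Relation.Nullary using (¬_)

record Graph (n : ℕ) : Set₁ where
  field
    Adj       : Fin n → Fin n → Set
    Adj-sym   : ∀ {u v} → Adj u v → Adj v u
    Adj-irrefl : ∀ {u} → ¬ Adj u u
open Graph public

data Walk {n : ℕ} (G : Graph n) : Fin n → Fin n → Set where
  [] : ∀ {u} → Walk G u u
  _∷_ : ∀ {u v w} → Adj G u v → Walk G v w → Walk G u w

Connected : ∀ {n} → Graph n → Set
Connected G = ∀ u v → Walk G u v

-- Final blue set produced by repeatedly applying the color change rule from B: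
-- v is blue if initially blue, or if some blue b adjacent to v has all its
-- other neighbours blue (so v was b's unique white neighbour, b → v).
data Blue {n : ℕ} (G : Graph n) (B : Subset n) : Fin n → Set where
  initial : ∀ {v} → v ∈ B → Blue G B v
  force   : ∀ {b v} → Blue G B b → Adj G b v →
            (∀ w → Adj G b w → w ≢ v → Blue G B w) → Blue G B v

IsZeroForcingSet : ∀ {n} → Graph n → Subset n → Set
IsZeroForcingSet G B = ∀ v → Blue G B v

IsFaultTolerantZFS : ∀ {n} → ℕ → Graph n → Subset n → Set
IsFaultTolerantZFS k G B =
  k ≤ ∣ B ∣ × (∀ F → F ⊆ B → ∣ F ∣ ≡ ∣ B ∣ ∸ k → IsZeroForcingSet G F)

ZtkExists : ∀ {n} → ℕ → Graph n → Set
ZtkExists k G = ∃ λ B → IsFaultTolerantZFS k G B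

ZtExists : ∀ {n} → Graph n → Set
ZtExists G = ZtkExists 1 G

{-# OPTIONS --safe #-}
-- On a single vertex every set B has at most one element, so deleting one element
-- leaves the empty set, which forces nothing. On at least two vertices V itself is
-- fault tolerant: deleting a vertex v leaves v as the only white vertex, and any
-- neighbour of v, which exists by connectivity, forces it.
module Submission where

open import Defs
open import Data.Nat using (ℕ; zero; suc; _≤_; _≥_; _∸_; s≤s; z≤n)
open import Data.Nat.Properties using (<-irrefl; m+n∸n≡m; m≤n⇒m∸n≡0; ≤-trans; ≤-refl)
open import Data.Fin using (Fin; zero; _≟_; punchIn)
open import Data.Fin.Properties using (punchInᵢ≢i)
open import Data.Fin.Subset using (Subset; _∈_; _∉_; _⊆_; _⊂_; ⁅_⁆; ∁; ∣_∣; ⊤; ⊥)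
open import Data.Fin.Subset.Properties
  using (_∈?_; ∉⊥; ⊥⊆; ∣⊥∣≡0; ∣⊤∣≡n; ∣p∣≤n; ∣∁p∣≡n∸∣p∣; ∣⁅x⁆∣≡1;
         x∈⁅y⁆⇒x≡y; x≢y⇒x∉⁅y⁆; x∉p⇒x∈∁p; p⊂q⇒∣p∣<∣q∣)
open import Data.Product using (∃; _,_; proj₂)
open import Function.Base using (_∘_)
open import Function.Bundles using (_⇔_; mk⇔)
open import Relation.Nullary using (¬_; yes; no; contradiction)
open import Relation.Nullary.Decidable using (decidable-stable)
open import Relation.Binary.PropositionalEquality using (_≡_; _≢_; refl; sym; trans; cong; subst; module ≡-Reasoning)

private
  variable
    n k : ℕ

-- The complement of a subset of size n in Fin (suc n) is a singleton, so it cannot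
-- strictly contain ⁅ x ⁆.
∣p∣≡n⇒∉-unique : {p : Subset (suc n)} {x y : Fin (suc n)} →
                 ∣ p ∣ ≡ n → x ∉ p → y ∉ p → x ≡ y
∣p∣≡n⇒∉-unique {n} {p} {x} {y} ∣p∣≡n x∉p y∉p with x ≟ y
... | yes x≡y = x≡y
... | no x≢y  = contradiction (p⊂q⇒∣p∣<∣q∣ ⁅x⁆⊂∁p) (<-irrefl ∣⁅x⁆∣≡∣∁p∣)
  where
  ⁅x⁆⊂∁p : ⁅ x ⁆ ⊂ ∁ p
  ⁅x⁆⊂∁p = (λ {z} z∈⁅x⁆ → x∉p⇒x∈∁p (subst (_∉ p) (sym (x∈⁅y⁆⇒x≡y x z∈⁅x⁆)) x∉p))
         , y , x∉p⇒x∈∁p y∉p , x≢y⇒x∉⁅y⁆ (x≢y ∘ sym)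
  open ≡-Reasoning
  ∣⁅x⁆∣≡∣∁p∣ : ∣ ⁅ x ⁆ ∣ ≡ ∣ ∁ p ∣
  ∣⁅x⁆∣≡∣∁p∣ = begin
    ∣ ⁅ x ⁆ ∣      ≡⟨ ∣⁅x⁆∣≡1 x ⟩
    1              ≡⟨ sym (m+n∸n≡m 1 n) ⟩
    suc n ∸ n      ≡⟨ cong (suc n ∸_) (sym ∣p∣≡n) ⟩
    suc n ∸ ∣ p ∣  ≡⟨ sym (∣∁p∣≡n∸∣p∣ p) ⟩
    ∣ ∁ p ∣        ∎

∣p∣≡n∧x∉p⇒y∈p : {p : Subset (suc n)} {x y : Fin (suc n)} →
                ∣ p ∣ ≡ n → x ∉ p → y ≢ x → y ∈ p
∣p∣≡n∧x∉p⇒y∈p {p = p} {y = y} ∣p∣≡n x∉p y≢x =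
  decidable-stable (y ∈? p) (λ y∉p → y≢x (∣p∣≡n⇒∉-unique ∣p∣≡n y∉p x∉p))

walk⇒neighbour : {G : Graph n} {u v : Fin n} → Walk G u v → u ≢ v → ∃ (Adj G u)
walk⇒neighbour []      u≢u = contradiction refl u≢u
walk⇒neighbour (a ∷ _) _   = _ , a

connected⇒neighbour : (G : Graph (suc (suc n))) → Connected G → ∀ v → ∃ (Adj G v)
connected⇒neighbour G conn v =
  walk⇒neighbour (conn v (punchIn v zero)) (punchInᵢ≢i v zero ∘ sym)

¬Blue-⊥ : (G : Graph n) {v : Fin n} → ¬ Blue G ⊥ v
¬Blue-⊥ G (initial v∈⊥)   = ∉⊥ v∈⊥
¬Blue-⊥ G (force b∈⊥ _ _) = ¬Blue-⊥ G b∈⊥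

Blue-onlyWhite : (G : Graph n) {F : Subset n} {v w : Fin n} →
                 (∀ u → u ≢ v → u ∈ F) → Adj G v w → Blue G F v
Blue-onlyWhite G {v = v} {w} others∈F v~w =
  force (initial (others∈F w w≢v)) (Adj-sym G v~w) (λ u _ u≢v → initial (others∈F u u≢v))
  where
  w≢v : w ≢ v
  w≢v refl = Adj-irrefl G v~w

¬ZtkExists : (G : Graph (suc n)) → suc n ≤ k → ¬ ZtkExists k G
¬ZtkExists {n} {k} G n<k (B , _ , subsets-force) =
  ¬Blue-⊥ G (subsets-force ⊥ ⊥⊆ ∣⊥∣≡∣B∣∸k zero)
  where
  ∣⊥∣≡∣B∣∸k : ∣ ⊥ {suc n} ∣ ≡ ∣ B ∣ ∸ k
  ∣⊥∣≡∣B∣∸k = trans (∣⊥∣≡0 (suc n)) (sym (m≤n⇒m∸n≡0 (≤-trans (∣p∣≤n B) n<k)))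

⊤-isFaultTolerantZFS : (G : Graph (suc (suc n))) → Connected G → IsFaultTolerantZFS 1 G ⊤
⊤-isFaultTolerantZFS {n} G conn = 1≤∣⊤∣ , ∣F∣≡∣⊤∣∸1⇒zfs
  where
  1≤∣⊤∣ : 1 ≤ ∣ ⊤ {suc (suc n)} ∣
  1≤∣⊤∣ = subst (1 ≤_) (sym (∣⊤∣≡n (suc (suc n)))) (s≤s z≤n)
  ∣F∣≡∣⊤∣∸1⇒zfs : ∀ F → F ⊆ ⊤ → ∣ F ∣ ≡ ∣ ⊤ {suc (suc n)} ∣ ∸ 1 → IsZeroForcingSet G F
  ∣F∣≡∣⊤∣∸1⇒zfs F _ ∣F∣≡∣⊤∣∸1 v with v ∈? F
  ... | yes v∈F = initial v∈F
  ... | no  v∉F = Blue-onlyWhite G (λ u u≢v → ∣p∣≡n∧x∉p⇒y∈p ∣F∣≡1+n v∉F u≢v)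
                                   (proj₂ (connected⇒neighbour G conn v))
    where
    ∣F∣≡1+n : ∣ F ∣ ≡ suc n
    ∣F∣≡1+n = trans ∣F∣≡∣⊤∣∸1 (cong (_∸ 1) (∣⊤∣≡n (suc (suc n))))

theorem2p10 : (n : ℕ) → n ≥ 1 → (G : Graph n) → Connected G →
    (ZtExists G ⇔ n ≢ 1)
theorem2p10 (suc zero)    _ G _    = mk⇔ (λ Zt _ → ¬ZtkExists G ≤-refl Zt) (λ 1≢1 → contradiction refl 1≢1)
theorem2p10 (suc (suc n)) _ G conn = mk⇔ (λ _ ()) (λ _ → ⊤ , ⊤-isFaultTolerantZFS G conn)
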